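{- Let $f=(f_1,\dots,f_n):\mathbb{F}_2^n\to\mathbb{F}_2^n$ be a conjunctive Boolean network, let $A=(a_{ij})$ be the $0/1$ matrix with $a_{ij}=1$ iff $x_j$ appears in $f_i$, let $c$ be the loop number of the dependency graph $\mathfrak{D}(f)$, and let $k$ be the least positive integer such that $A^{k+c}=A^k$ (Boolean powers). Then the height of $f$ is $\mathrm{h}(f)=k$ and the period $\mathrm{p}(f)$ divides $c$. In particular $C(f)_i=0$ for every $i$ not dividing $c$, so $\mathcal{C}(f)=\sum_{i\mid c} C(f)_i\,\mathcal{C}_i$.
   Context: $\mathbb{F}_2=\{0,1\}$. A conjunctive Boolean network is a map $f=(f_1,\dots,f_n):\mathbb{F}_2^n\to\mathbb{F}_2^n$ where each $f_i$ is a product (AND) of a nonempty set of variables. Its dependency graph $\mathfrak{D}(f)$ has vertices $1,\dots,n$ and an edge $i\to j$ iff $x_i$ appears in $f_j$. Boolean matrix product: $(A\otimes B)_{ij}=\bigvee_k (A_{ik}\wedge B_{kj})$, and $A^s$ is the $s$-fold Boolean product. Strongly connected components are the subgraphs induced on the classes of mutual reachability; a component is trivial if it has no edges. The loop number of a nontrivial strongly connected graph is the gcd of the lengths of its simple directed cycles; of a trivial one it is $0$; the loop number of a general directed graph is the lcm of the loop numbers of its nontrivial strongly connected components. A limit cycle of length $t$ is a set $\{\mathbf{u},f(\mathbf{u}),\dots,f^{t-1}(\mathbf{u})\}$ with $f^t(\mathbf{u})=\mathbf{u}$, $t$ minimal. The height $\mathrm{h}(f)$ is the least positive $s$ such that $f^s(\mathbf{u})$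 is periodic for all $\mathbf{u}$; the period $\mathrm{p}(f)$ is the lcm of all limit cycle lengths. The cycle structure is the formal sum $\mathcal{C}(f)=\sum_{i\ge1}C(f)_i\mathcal{C}_i$, $C(f)_i$ being the number of limit cycles of length $i$. -}

module Defs where

open import Data.Bool using (Bool; true; false; _∧_; _∨_; not)
open import Data.Nat using (ℕ; zero; suc; _+_; _≤_)
open import Data.Nat.Divisibility using (_∣_)
open import Data.Fin using (Fin; zero; suc; _≟_)
open import Data.Vec using (Vec; tabulate; lookup)
open import Data.List using (List; []; _∷_; _++_; [_]; length)
open import Data.List.Relation.Unary.All using (All)
open import Data.List.Relation.Unary.Linked using (Linked)
open import Data.List.Relation.Unary.Unique.Propositional using (Unique)
open import Data.Product using (Σ; ∃; ∃-syntax; _×_)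
open import Relation.Binary.PropositionalEquality using (_≡_)
open import Relation.Binary.Construct.Closure.ReflexiveTransitive using (Star)
open import Relation.Nullary.Decidable using (⌊_⌋)

Matrix : ℕ → Set
Matrix n = Fin n → Fin n → Bool

andF : ∀ n → (Fin n → Bool) → Bool
andF zero    g = true
andF (suc n) g = g zero ∧ andF n (λ i → g (suc i))

orF : ∀ n → (Fin n → Bool) → Bool
orF zero    g = false
orF (suc n) g = g zero ∨ orF n (λ i → g (suc i))

_⊗_ : ∀ {n} → Matrix n → Matrix n → Matrix n
_⊗_ {n} A B i j = orF n (λ k → A i k ∧ B k j)

idM : ∀ {n} → Matrix n
idM i j = ⌊ i ≟ j ⌋

mpow : ∀ {n} → Matrix n → ℕ → Matrix n
mpow A zero    = idM
mpow A (suc s) = A ⊗ mpow A s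

MatEq : ∀ {n} → Matrix n → Matrix n → Set
MatEq A B = ∀ i j → A i j ≡ B i j

-- The conjunctive network with matrix A: A i j = true iff x_j appears in f_i.
-- Conjunctive: every f_i is a product of a nonempty set of variables.
IsConjunctive : ∀ {n} → Matrix n → Set
IsConjunctive {n} A = ∀ (i : Fin n) → ∃[ j ] (A i j ≡ true)

step : ∀ {n} → Matrix n → Vec Bool n → Vec Bool n
step {n} A x = tabulate (λ i → andF n (λ j → not (A i j) ∨ lookup x j))

iter : ∀ {n} → Matrix n → ℕ → Vec Bool n → Vec Bool n
iter A zero    x = x
iter A (suc s) x = step A (iter A s x)

-- Dependency graph: edge i → j iff x_i appears in f_j
Edge : ∀ {n} → Matrix n → Fin n → Fin n → Set
Edge A i j = A j i ≡ true

Reach : ∀ {n} → Matrix n → Fin n → Fin n → Set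
Reach A = Star (Edge A)

InClass : ∀ {n} → Matrix n → Fin n → Fin n → Set
InClass A v w = Reach A v w × Reach A w v

Nontrivial : ∀ {n} → Matrix n → Fin n → Set
Nontrivial A v = ∃[ i ] ∃[ j ] (InClass A v i × InClass A v j × Edge A i j)

SimpleCycle : ∀ {n} → Matrix n → Fin n → List (Fin n) → Set
SimpleCycle A u ws = Unique (u ∷ ws) × Linked (Edge A) (u ∷ ws ++ [ u ])

CycleLengthIn : ∀ {n} → Matrix n → Fin n → ℕ → Set
CycleLengthIn A v l =
  ∃[ u ] ∃[ ws ] (SimpleCycle A u ws × All (InClass A v) (u ∷ ws) × l ≡ suc (length ws))

IsGcdOf : (ℕ → Set) → ℕ → Set
IsGcdOf P g = (∀ l → P l → g ∣ l) × (∀ d → (∀ l → P l → d ∣ l) → d ∣ g)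

IsLcmOf : (ℕ → Set) → ℕ → Set
IsLcmOf P m = (∀ l → P l → l ∣ m) × (∀ d → (∀ l → P l → l ∣ d) → m ∣ d)

ComponentLoopNumber : ∀ {n} → Matrix n → ℕ → Set
ComponentLoopNumber A g = ∃[ v ] (Nontrivial A v × IsGcdOf (CycleLengthIn A v) g)

IsLoopNumber : ∀ {n} → Matrix n → ℕ → Set
IsLoopNumber A c = IsLcmOf (ComponentLoopNumber A) c

IsLeastPos : (ℕ → Set) → ℕ → Set
IsLeastPos P k = 1 ≤ k × P k × (∀ m → 1 ≤ m → P m → k ≤ m)

IsPeriodicState : ∀ {n} → Matrix n → Vec Bool n → Set
IsPeriodicState A u = ∃[ t ] (1 ≤ t × iter A t u ≡ u)

IsHeight : ∀ {n} → Matrix n → ℕ → Set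
IsHeight A h = IsLeastPos (λ s → ∀ u → IsPeriodicState A (iter A s u)) h

LimitCycleLength : ∀ {n} → Matrix n → ℕ → Set
LimitCycleLength A t = ∃[ u ] IsLeastPos (λ s → iter A s u ≡ u) t

IsPeriod : ∀ {n} → Matrix n → ℕ → Set
IsPeriod A p = IsLcmOf (LimitCycleLength A) p

-- Iterating the network computes Boolean matrix powers: coordinate i of f^s(x) is 1 iff
-- x_j = 1 for every j with (A^s)_ij = 1, i.e. f^s is the one-step network of A^s.
-- Evaluating at the vectors with a single 0 shows that f^a = f^b iff A^a = A^b, so k is
-- also the least positive k with f^(k+c) = f^k.  A periodic point u of period t is fixed
-- by f^(kt), and kt ≥ k gives f^c(u) = f^(c+kt)(u) = f^(kt)(u) = u; hence every limit cycle
-- length divides c, and f^k(u) is periodic since f^c fixes it.  Conversely, if all points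
-- of the image of f^m are periodic, f^c fixes them, so f^(m+c) = f^m and A^(m+c) = A^m,
-- whence k ≤ m.  All of this needs c ≠ 0: the loop number of a nontrivial component
-- divides the length of one of its simple cycles, which is at most n, so c divides n!.
module Submission where

open import Defs
open import Data.Nat using (ℕ; _+_)
open import Data.Nat.Divisibility using (_∣_)
open import Data.Product using (_×_)

open import Data.Bool using (Bool; true; false; _∧_; _∨_; not)
open import Data.Bool.Properties using (∧-conicalˡ; ∧-conicalʳ; not-injective)
open import Data.Empty using (⊥-elim)
open import Data.Fin as Fin using (Fin; _≟_)
open import Data.Fin.Properties using (pigeonhole)
open import Data.List as List using (List; []; _∷_; _++_; [_]; length)
open import Data.List.Membership.Propositional.Properties using (∈-lookup)
open import Data.List.Relation.Unary.All as All using (All; []; _∷_)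
open import Data.List.Relation.Unary.All.Properties using (¬Any⇒All¬)
open import Data.List.Relation.Unary.Any using (Any; here; there; any?)
open import Data.List.Relation.Unary.AllPairs as AllPairs using (_∷_)
open import Data.List.Relation.Unary.Linked using (Linked; [-]; _∷_)
open import Data.List.Relation.Unary.Unique.Propositional using (Unique)
open import Data.Nat using (zero; suc; _*_; _∸_; _≤_; _<_; _!; z≤n; s≤s; _≤?_)
open import Data.Nat.DivMod using (_%_; _/_; m≡m%n+[m/n]*n; m%n<n)
open import Data.Nat.Divisibility using (m∣m*n; ∣-trans; ∣⇒≤; 0∣⇒≡0; m≤n⇒m!∣n!; m%n≡0⇒n∣m)
open import Data.Nat.Properties
  using (+-comm; ≤-trans; ≰⇒>; <⇒≱; <⇒≢; m≤m*n; m∸n+n≡m; 1≤n!)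
open import Data.Product using (∃-syntax; _,_)
open import Data.Vec using (Vec; tabulate; lookup)
open import Data.Vec.Properties using (lookup∘tabulate; tabulate∘lookup; tabulate-cong)
open import Relation.Binary.Construct.Closure.ReflexiveTransitive using (Star; ε; _◅_; _◅◅_)
open import Relation.Binary.Definitions using (DecidableEquality)
open import Relation.Binary.PropositionalEquality
  using (_≡_; _≢_; _≗_; refl; sym; trans; cong; cong₂; subst; module ≡-Reasoning)
open import Relation.Nullary using (yes; no)
open import Relation.Nullary.Decidable using (⌊_⌋)

≡true-ext : ∀ {a b : Bool} → (a ≡ true → b ≡ true) → (b ≡ true → a ≡ true) → a ≡ b
≡true-ext {true}  a⇒b _ = sym (a⇒b refl)
≡true-ext {false} {true}  _ b⇒a = b⇒a refl
≡true-ext {false} {false} _ _   = refl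

not∨≡true⇒ : ∀ {a b} → not a ∨ b ≡ true → a ≡ true → b ≡ true
not∨≡true⇒ h refl = h

⇒not∨≡true : ∀ a {b} → (a ≡ true → b ≡ true) → not a ∨ b ≡ true
⇒not∨≡true true  a⇒b = a⇒b refl
⇒not∨≡true false _   = refl

andF≡true⇒ : ∀ n {g : Fin n → Bool} → andF n g ≡ true → ∀ j → g j ≡ true
andF≡true⇒ (suc n) {g} h Fin.zero    = ∧-conicalˡ (g Fin.zero) _ h
andF≡true⇒ (suc n) {g} h (Fin.suc j) = andF≡true⇒ n (∧-conicalʳ (g Fin.zero) _ h) j

⇒andF≡true : ∀ n {g : Fin n → Bool} → (∀ j → g j ≡ true) → andF n g ≡ true
⇒andF≡true zero    h = refl
⇒andF≡true (suc n) h = cong₂ _∧_ (h Fin.zero) (⇒andF≡true n (λ j → h (Fin.suc j)))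

orF≡true⇒ : ∀ n (g : Fin n → Bool) → orF n g ≡ true → ∃[ j ] g j ≡ true
orF≡true⇒ (suc n) g h with g Fin.zero in eq
... | true  = Fin.zero , eq
... | false with j , gj ← orF≡true⇒ n (λ i → g (Fin.suc i)) h = Fin.suc j , gj

⇒orF≡true : ∀ n (g : Fin n → Bool) j → g j ≡ true → orF n g ≡ true
⇒orF≡true (suc n) g Fin.zero    gj rewrite gj = refl
⇒orF≡true (suc n) g (Fin.suc j) gj with g Fin.zero
... | true  = refl
... | false = ⇒orF≡true n (λ i → g (Fin.suc i)) j gj

⇒vec-≡ : ∀ {A : Set} {n} {xs ys : Vec A n} → (∀ i → lookup xs i ≡ lookup ys i) → xs ≡ ys
⇒vec-≡ {xs = xs} {ys} h = begin
  xs                   ≡⟨ sym (tabulate∘lookup xs) ⟩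
  tabulate (lookup xs) ≡⟨ tabulate-cong h ⟩
  tabulate (lookup ys) ≡⟨ tabulate∘lookup ys ⟩
  ys                   ∎
  where open ≡-Reasoning

Admissible : ∀ {n} → Matrix n → Vec Bool n → Fin n → Set
Admissible B x i = ∀ j → B i j ≡ true → lookup x j ≡ true

step≡true⇒ : ∀ {n} (B : Matrix n) x i → lookup (step B x) i ≡ true → Admissible B x i
step≡true⇒ {n} B x i h j bij =
  not∨≡true⇒ (andF≡true⇒ n (trans (sym (lookup∘tabulate _ i)) h) j) bij

⇒step≡true : ∀ {n} (B : Matrix n) x i → Admissible B x i → lookup (step B x) i ≡ true
⇒step≡true {n} B x i h =
  trans (lookup∘tabulate _ i) (⇒andF≡true n (λ j → ⇒not∨≡true (B i j) (h j)))

lookup-step≡ : ∀ {n} (B : Matrix n) x i {b} →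
  (Admissible B x i → b ≡ true) → (b ≡ true → Admissible B x i) → lookup (step B x) i ≡ b
lookup-step≡ B x i ⇒b b⇒ = ≡true-ext (λ h → ⇒b (step≡true⇒ B x i h)) (λ h → ⇒step≡true B x i (b⇒ h))

step-cong : ∀ {n} {B C : Matrix n} → MatEq B C → ∀ x → step B x ≡ step C x
step-cong {B = B} {C} B≈C x = ⇒vec-≡ λ i → lookup-step≡ B x i
  (λ adm → ⇒step≡true C x i (λ j cij → adm j (trans (B≈C i j) cij)))
  (λ h j bij → step≡true⇒ C x i h j (trans (sym (B≈C i j)) bij))

step-idM : ∀ {n} (x : Vec Bool n) → step idM x ≡ x
step-idM x = ⇒vec-≡ λ i → lookup-step≡ idM x i (λ adm → adm i (i≟i i)) (λ xi j → diagonal xi j)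
  where
  i≟i : ∀ {n} (i : Fin n) → ⌊ i ≟ i ⌋ ≡ true
  i≟i i with i ≟ i
  ... | yes _  = refl
  ... | no i≢i = ⊥-elim (i≢i refl)
  diagonal : ∀ {i} → lookup x i ≡ true → ∀ j → ⌊ i ≟ j ⌋ ≡ true → lookup x j ≡ true
  diagonal {i} xi j _ with i ≟ j
  diagonal xi j _ | yes refl = xi

step-⊗ : ∀ {n} (A B : Matrix n) x → step A (step B x) ≡ step (A ⊗ B) x
step-⊗ {n} A B x = ⇒vec-≡ λ i → lookup-step≡ A (step B x) i
  (λ adm → ⇒step≡true (A ⊗ B) x i λ l abil →
    let j , aij∧bjl = orF≡true⇒ n (λ j → A i j ∧ B j l) abil
    in step≡true⇒ B x j (adm j (∧-conicalˡ _ _ aij∧bjl)) l (∧-conicalʳ _ _ aij∧bjl))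
  (λ h j aij → ⇒step≡true B x j λ l bjl →
    step≡true⇒ (A ⊗ B) x i h l (⇒orF≡true n (λ j → A i j ∧ B j l) j (cong₂ _∧_ aij bjl)))

allBut : ∀ {n} → Fin n → Vec Bool n
allBut j = tabulate (λ l → not ⌊ l ≟ j ⌋)

lookup-allBut-self : ∀ {n} (j : Fin n) → lookup (allBut j) j ≢ true
lookup-allBut-self j h rewrite lookup∘tabulate (λ l → not ⌊ l ≟ j ⌋) j with j ≟ j | h
... | yes _  | ()
... | no j≢j | _ = j≢j refl

lookup-allBut-other : ∀ {n} {j l : Fin n} → l ≢ j → lookup (allBut j) l ≡ true
lookup-allBut-other {j = j} {l} l≢j rewrite lookup∘tabulate (λ l → not ⌊ l ≟ j ⌋) l with l ≟ j
... | yes l≡j = ⊥-elim (l≢j l≡j)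
... | no _    = refl

lookup-step-allBut : ∀ {n} (B : Matrix n) i j → lookup (step B (allBut j)) i ≡ not (B i j)
lookup-step-allBut B i j = lookup-step≡ B (allBut j) i
  (λ adm → ⇒not≡true (λ bij → lookup-allBut-self j (adm j bij)))
  (λ nbij l bil → lookup-allBut-other {j = j} {l} (λ { refl → not≡true⇒ nbij bil }))
  where
  ⇒not≡true : ∀ {b} → b ≢ true → not b ≡ true
  ⇒not≡true {true}  b≢true = ⊥-elim (b≢true refl)
  ⇒not≡true {false} _      = refl
  not≡true⇒ : ∀ {b} → not b ≡ true → b ≢ true
  not≡true⇒ () refl

step-injective : ∀ {n} {B C : Matrix n} → step B ≗ step C → MatEq B C
step-injective {B = B} {C} B≗C i j = not-injective (begin
  not (B i j)                 ≡⟨ sym (lookup-step-allBut B i j) ⟩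
  lookup (step B (allBut j)) i ≡⟨ cong (λ v → lookup v i) (B≗C (allBut j)) ⟩
  lookup (step C (allBut j)) i ≡⟨ lookup-step-allBut C i j ⟩
  not (C i j)                 ∎)
  where open ≡-Reasoning

iter≗step-mpow : ∀ {n} (A : Matrix n) s → iter A s ≗ step (mpow A s)
iter≗step-mpow A zero    x = sym (step-idM x)
iter≗step-mpow A (suc s) x = trans (cong (step A) (iter≗step-mpow A s x)) (step-⊗ A (mpow A s) x)

iter≗⇒mpow≈ : ∀ {n} (A : Matrix n) a b → iter A a ≗ iter A b → MatEq (mpow A a) (mpow A b)
iter≗⇒mpow≈ A a b eq = step-injective λ x →
  trans (sym (iter≗step-mpow A a x)) (trans (eq x) (iter≗step-mpow A b x))

mpow≈⇒iter≗ : ∀ {n} (A : Matrix n) a b → MatEq (mpow A a) (mpow A b) → iter A a ≗ iter A b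
mpow≈⇒iter≗ A a b eq x =
  trans (iter≗step-mpow A a x) (trans (step-cong eq x) (sym (iter≗step-mpow A b x)))

iter-+ : ∀ {n} (A : Matrix n) a b x → iter A (a + b) x ≡ iter A a (iter A b x)
iter-+ A zero    b x = refl
iter-+ A (suc a) b x = cong (step A) (iter-+ A a b x)

iter-+′ : ∀ {n} (A : Matrix n) a b x → iter A (a + b) x ≡ iter A b (iter A a x)
iter-+′ A a b x = trans (cong (λ s → iter A s x) (+-comm a b)) (iter-+ A b a x)

iter-*-fixed : ∀ {n} (A : Matrix n) {t u} → iter A t u ≡ u → ∀ m → iter A (m * t) u ≡ u
iter-*-fixed A         e zero    = refl
iter-*-fixed A {t} {u} e (suc m) =
  trans (iter-+ A t (m * t) u) (trans (cong (iter A t) (iter-*-fixed A e m)) e)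

iter-+-stable : ∀ {n} (A : Matrix n) {k c} → iter A (k + c) ≗ iter A k →
  ∀ {s} → k ≤ s → iter A (s + c) ≗ iter A s
iter-+-stable A {k} {c} stable {s} k≤s x =
  subst (λ s → iter A (s + c) x ≡ iter A s x) (m∸n+n≡m k≤s) (shifted (s ∸ k))
  where
  shifted : ∀ o → iter A (o + k + c) x ≡ iter A (o + k) x
  shifted zero    = stable x
  shifted (suc o) = cong (step A) (shifted o)

periodic⇒iter-fixed : ∀ {n} (A : Matrix n) k c → iter A (k + c) ≗ iter A k →
  ∀ {u} → IsPeriodicState A u → iter A c u ≡ u
periodic⇒iter-fixed A k c stable {u} (suc t , _ , e) = begin
  iter A c u                         ≡⟨ cong (iter A c) (sym (iter-*-fixed A e k)) ⟩
  iter A c (iter A (k * suc t) u)    ≡⟨ sym (iter-+ A c (k * suc t) u) ⟩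
  iter A (c + k * suc t) u           ≡⟨ cong (λ s → iter A s u) (+-comm c (k * suc t)) ⟩
  iter A (k * suc t + c) u           ≡⟨ iter-+-stable A {k} {c} stable (m≤m*n k (suc t)) u ⟩
  iter A (k * suc t) u               ≡⟨ iter-*-fixed A e k ⟩
  u                                  ∎
  where open ≡-Reasoning

leastPeriod-∣ : ∀ {n} (A : Matrix n) {u t m} →
  IsLeastPos (λ s → iter A s u ≡ u) t → iter A m u ≡ u → t ∣ m
leastPeriod-∣ A {u} {t@(suc _)} {m} (_ , e , least) em =
  m%n≡0⇒n∣m m t (remainder≡0 (m % t) er (m%n<n m t))
  where
  open ≡-Reasoning
  er : iter A (m % t) u ≡ u
  er = begin
    iter A (m % t) u                      ≡⟨ cong (iter A (m % t)) (sym (iter-*-fixed A {t} e (m / t))) ⟩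
    iter A (m % t) (iter A (m / t * t) u) ≡⟨ sym (iter-+ A (m % t) _ u) ⟩
    iter A (m % t + m / t * t) u          ≡⟨ cong (λ s → iter A s u) (m≡m%n+[m/n]*n m t) ⟨
    iter A m u                            ≡⟨ em ⟩
    u                                     ∎
  remainder≡0 : ∀ r → iter A r u ≡ u → r < t → r ≡ 0
  remainder≡0 zero    _  _   = refl
  remainder≡0 (suc r) er r<t = ⊥-elim (<⇒≱ r<t (least (suc r) (s≤s z≤n) er))

module _ {X : Set} (_≟X_ : DecidableEquality X) (R : X → X → Set) where

  SimpleWalk : X → X → Set
  SimpleWalk a b = ∃[ ws ] (Unique (a ∷ ws) × Linked R (a ∷ ws ++ [ b ]))

  private
    suffixFrom : ∀ {a b} y ws → Any (a ≡_) (y ∷ ws) → Unique (y ∷ ws) →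
      Linked R (y ∷ ws ++ [ b ]) → SimpleWalk a b
    suffixFrom y ws        (here refl) u l = ws , u , l
    suffixFrom y (w ∷ ws) (there a∈ws) (_ ∷ u) (_ ∷ l) = suffixFrom w ws a∈ws u l

  simplifyWalk : ∀ {a y b} → R a y → Star R y b → SimpleWalk a b
  simplifyWalk r ε = [] , [] ∷ AllPairs.[] , r ∷ [-]
  simplifyWalk {a} r (r′ ◅ s) with ws , u , l ← simplifyWalk r′ s | any? (a ≟X_) (_ ∷ ws)
  ... | yes a∈ws = suffixFrom _ ws a∈ws u l
  ... | no  a∉ws = _ ∷ ws , ¬Any⇒All¬ _ a∉ws ∷ u , r ∷ l

  walk-vertices-between : ∀ {b} a ws → Linked R (a ∷ ws ++ [ b ]) →
    All (λ w → Star R a w × Star R w b) (a ∷ ws)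
  walk-vertices-between a []       (r ∷ [-]) = (ε , r ◅ ε) ∷ []
  walk-vertices-between a (w ∷ ws) (r ∷ l)   with (_ , w⇝b) ∷ rest ← walk-vertices-between w ws l =
    (ε , r ◅ w⇝b) ∷ All.map (λ (w⇝v , v⇝b) → r ◅ w⇝v , v⇝b) ((ε , w⇝b) ∷ rest)

Unique⇒length≤ : ∀ {n} (xs : List (Fin n)) → Unique xs → length xs ≤ n
Unique⇒length≤ {n} xs u with length xs ≤? n
... | yes ≤n = ≤n
... | no  ≰n with i , j , i<j , xsᵢ≡xsⱼ ← pigeonhole (≰⇒> ≰n) (List.lookup xs) =
  ⊥-elim (distinct u i j i<j xsᵢ≡xsⱼ)
  where
  distinct : ∀ {ys : List (Fin n)} → Unique ys → ∀ i j → i Fin.< j → List.lookup ys i ≢ List.lookup ys j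
  distinct (y∉ ∷ _) Fin.zero    (Fin.suc j) _         = All.lookup y∉ (∈-lookup j)
  distinct (_ ∷ u)  (Fin.suc i) (Fin.suc j) (s≤s i<j) = distinct u i j i<j

nontrivial⇒shortCycle : ∀ {n} (A : Matrix n) {v} → Nontrivial A v →
  ∃[ m ] (CycleLengthIn A v (suc m) × suc m ≤ n)
nontrivial⇒shortCycle A (i , j , (v⇝i , i⇝v) , (v⇝j , j⇝v) , i→j)
  with ws , unique , linked ← simplifyWalk _≟_ (Edge A) i→j (j⇝v ◅◅ v⇝i) =
  length ws , (i , ws , (unique , linked) , inClass , refl) , Unique⇒length≤ (i ∷ ws) unique
  where
  inClass : All (InClass A _) (i ∷ ws)
  inClass = All.map (λ (i⇝w , w⇝i) → v⇝i ◅◅ i⇝w , w⇝i ◅◅ i⇝v)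
                    (walk-vertices-between _≟_ (Edge A) i ws linked)

0<m≤n⇒m∣n! : ∀ {m n} → 0 < m → m ≤ n → m ∣ n !
0<m≤n⇒m∣n! {suc m} _ m≤n = ∣-trans (m∣m*n (m !)) (m≤n⇒m!∣n! m≤n)

componentLoopNumber∣n! : ∀ {n} (A : Matrix n) {g} → ComponentLoopNumber A g → g ∣ n !
componentLoopNumber∣n! A (v , nontrivial , g∣cycles , _)
  with m , cycle , m<n ← nontrivial⇒shortCycle A nontrivial =
  0<m≤n⇒m∣n! (positive g∣m) (≤-trans (∣⇒≤ g∣m) m<n)
  where
  g∣m = g∣cycles (suc m) cycle
  positive : ∀ {g} → g ∣ suc m → 0 < g
  positive {zero}  0∣m with () ← 0∣⇒≡0 0∣m
  positive {suc g} _ = s≤s z≤n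

loopNumber-positive : ∀ {n} (A : Matrix n) {c} → IsLoopNumber A c → 0 < c
loopNumber-positive {n} A {zero}  (_ , least) =
  ⊥-elim (<⇒≢ (1≤n! n) (sym (0∣⇒≡0 (least (n !) λ _ → componentLoopNumber∣n! A))))
loopNumber-positive     A {suc c} _ = s≤s z≤n

mainTheorem3 : (n : ℕ) (A : Matrix n) → IsConjunctive A →
    (c k : ℕ) → IsLoopNumber A c →
    IsLeastPos (λ s → MatEq (mpow A (s + c)) (mpow A s)) k →
    IsHeight A k × (∀ p → IsPeriod A p → p ∣ c) × (∀ t → LimitCycleLength A t → t ∣ c)
mainTheorem3 n A _ c k loopNumber (k≥1 , Aᵏ⁺ᶜ≈Aᵏ , kLeast) = height , period∣c , cycleLength∣c
  where
  stable : iter A (k + c) ≗ iter A k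
  stable = mpow≈⇒iter≗ A (k + c) k Aᵏ⁺ᶜ≈Aᵏ

  cycleLength∣c : ∀ t → LimitCycleLength A t → t ∣ c
  cycleLength∣c t (u , least@(t≥1 , fixed , _)) =
    leastPeriod-∣ A least (periodic⇒iter-fixed A k c stable (t , t≥1 , fixed))

  period∣c : ∀ p → IsPeriod A p → p ∣ c
  period∣c p (_ , lcmLeast) = lcmLeast c cycleLength∣c

  height : IsHeight A k
  height = k≥1
    , (λ u → c , loopNumber-positive A loopNumber , trans (sym (iter-+′ A k c u)) (stable u))
    , λ m m≥1 periodic → kLeast m m≥1 (iter≗⇒mpow≈ A (m + c) m λ x →
        trans (iter-+′ A m c x) (periodic⇒iter-fixed A k c stable (periodic x)))
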